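{- For every $n\ge1$, the set of wiggly permutations of $[2n]$ is a sublattice of the (left) weak order on permutations of $[2n]$, i.e. it is closed under the join and meet of the weak order.
   Context: A wiggly permutation is a permutation of $[2n]$ that avoids the patterns $(2j-1)\cdots i\cdots(2j)$ for $j\in[n]$ and $i<2j-1$, and $(2j)\cdots k\cdots(2j-1)$ for $j\in[n]$ and $k>2j$ (that is, no value $i<2j-1$ appears between $2j-1$ and $2j$ when $2j-1$ comes first, and no value $k>2j$ appears between $2j$ and $2j-1$ when $2j$ comes first). The inversion set of a permutation $\sigma$ is $\mathrm{inv}(\sigma)=\{(\sigma(i),\sigma(j)) : 1\le i<j\le 2n,\ \sigma(i)>\sigma(j)\}$, and the weak order is $\sigma\le\tau$ iff $\mathrm{inv}(\sigma)\subseteq\mathrm{inv}(\tau)$; it is a lattice. -}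

module Defs where

open import Data.Nat using (ℕ; _<_; _*_; _+_)
open import Data.Fin using (Fin; toℕ)
open import Data.Fin.Permutation using (Permutation′; _⟨$⟩ʳ_)
open import Data.Product using (Σ; _×_)
open import Relation.Binary.PropositionalEquality using (_≡_)
open import Relation.Nullary using (¬_)

-- Permutations of [m] are bijections Fin m → Fin m; position i ↦ value σ(i).
-- Positions and values are 0-indexed: paper's value v corresponds to v - 1 here.

val : ∀ {m} → Permutation′ m → Fin m → ℕ
val σ i = toℕ (σ ⟨$⟩ʳ i)

Inv : ∀ {m} → Permutation′ m → ℕ → ℕ → Set
Inv {m} σ a b =
  Σ (Fin m) λ i → Σ (Fin m) λ j →
    (toℕ i < toℕ j) × (val σ i ≡ a) × (val σ j ≡ b) × (b < a)

_≤W_ : ∀ {m} → Permutation′ m → Permutation′ m → Set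
σ ≤W τ = ∀ a b → Inv σ a b → Inv τ a b

IsJoin : ∀ {m} → Permutation′ m → Permutation′ m → Permutation′ m → Set
IsJoin {m} σ τ ρ =
  (σ ≤W ρ) × (τ ≤W ρ) × (∀ (π : Permutation′ m) → σ ≤W π → τ ≤W π → ρ ≤W π)

IsMeet : ∀ {m} → Permutation′ m → Permutation′ m → Permutation′ m → Set
IsMeet {m} σ τ ρ =
  (ρ ≤W σ) × (ρ ≤W τ) × (∀ (π : Permutation′ m) → π ≤W σ → π ≤W τ → π ≤W ρ)

-- With 0-indexed values, the paper's pair
-- (2j-1, 2j), j ∈ [n], is (2k, 2k+1), k < n.
Wiggly : (n : ℕ) → Permutation′ (2 * n) → Set
Wiggly n σ =
  ∀ (k : ℕ) → k < n → ∀ (p q r : Fin (2 * n)) → toℕ p < toℕ q → toℕ q < toℕ r →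
    ¬ ((val σ p ≡ 2 * k) × (val σ r ≡ 2 * k + 1) × (val σ q < 2 * k))
  × ¬ ((val σ p ≡ 2 * k + 1) × (val σ r ≡ 2 * k) × (2 * k + 1 < val σ q))

{-# OPTIONS --safe #-}
-- The inversion set of σ ∨ τ is the transitive closure of inv σ ∪ inv τ, and a permutation of [2n] is
-- wiggly iff its inversion set is closed under two rules (with 0-indexed values): an inversion (2k, a)
-- forces (2k+1, a), and an inversion (a, 2k) with a > 2k+1 forces (a, 2k+1). Both rules survive unions
-- and transitive closures, so joins of wiggly permutations are wiggly.
-- Every inversion of σ ∨ τ lies in the closure: a descent outside it could be swapped away, giving an
-- upper bound of σ and τ without that inversion; and descents propagate to all inversions because the
-- closure is transitive and cotransitive. Membership in the closure is not decided, so this is shown up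
-- to double negation, which suffices since wiggliness is a negative property.
-- Meets reduce to joins through the value complement v ↦ 2n-1-v, an order-reversing involution of the
-- weak order that exchanges the two forbidden patterns and hence preserves wiggliness.

module Submission where

open import Defs
open import Level using (Level; 0ℓ)
open import Data.Nat using (ℕ; zero; suc; _≤_; _<_; _>_; _*_; _+_; _∸_; s≤s; z<s)
open import Data.Nat.Properties
open import Data.Nat.Tactic.RingSolver using (solve-∀)
open import Data.Fin using (Fin; toℕ; fromℕ<; opposite)
open import Data.Fin.Properties
  using (toℕ-injective; toℕ<n; toℕ-fromℕ<; opposite-prop; opposite-involutive) renaming (_≟_ to _≟ᶠ_)
open import Data.Fin.Permutation
  using (Permutation′; _⟨$⟩ʳ_; _⟨$⟩ˡ_; inverseˡ; inverseʳ; transpose; reverse; _∘ₚ_; _≈_)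
import Data.Fin.Permutation.Components as PC
open import Data.Product using (∃; _×_; _,_; proj₁; proj₂)
open import Data.Sum as Sum using (_⊎_; inj₁; inj₂; [_,_]′)
open import Function using (_∘_; id)
open import Relation.Binary using (Rel; _⇒_; Transitive; tri<; tri≈; tri>)
open import Relation.Binary.Construct.Closure.Transitive using (TransClosure; [_]; _∷_; _++_)
open import Relation.Binary.Construct.Union using (_∪_)
open import Relation.Binary.PropositionalEquality
open import Relation.Nullary using (¬_; yes; no; contradiction)
open import Relation.Nullary.Negation using (¬¬-Monad)
open import Effect.Monad using (RawMonad)

private variable
  ℓ ℓ′ ℓ″ : Level
  A : Set ℓ″
  m n k a b c : ℕ
  R : Rel ℕ ℓ
  S : Rel ℕ ℓ′

val-injective : (ρ : Permutation′ m) {i j : Fin m} → val ρ i ≡ val ρ j → i ≡ j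
val-injective ρ {i} {j} eq = begin
  i                   ≡⟨ inverseˡ ρ ⟨
  ρ ⟨$⟩ˡ (ρ ⟨$⟩ʳ i)  ≡⟨ cong (ρ ⟨$⟩ˡ_) (toℕ-injective eq) ⟩
  ρ ⟨$⟩ˡ (ρ ⟨$⟩ʳ j)  ≡⟨ inverseˡ ρ ⟩
  j                   ∎
  where open ≡-Reasoning

position-of : (ρ : Permutation′ m) → a < m → ∃ λ i → val ρ i ≡ a
position-of ρ a<m = ρ ⟨$⟩ˡ fromℕ< a<m , trans (cong toℕ (inverseʳ ρ)) (toℕ-fromℕ< a<m)

inv-positions : (ρ : Permutation′ m) {i j : Fin m} →
  Inv ρ a b → val ρ i ≡ a → val ρ j ≡ b → toℕ i < toℕ j
inv-positions ρ (p , q , p<q , refl , refl , _) eᵢ eⱼ with val-injective ρ eᵢ | val-injective ρ eⱼ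
... | refl | refl = p<q

inv-descending : (ρ : Permutation′ m) → Inv ρ ⇒ _>_
inv-descending ρ (_ , _ , _ , _ , _ , b<a) = b<a

inv-trans : (ρ : Permutation′ m) → Transitive (Inv ρ)
inv-trans ρ (i , j , i<j , eᵢ , eⱼ , b<a) (j′ , k , j′<k , eⱼ′ , eₖ , c<b)
  with val-injective ρ (trans eⱼ (sym eⱼ′))
... | refl = i , k , <-trans i<j j′<k , eᵢ , eₖ , <-trans c<b b<a

inv-cotrans : (ρ : Permutation′ m) → Inv ρ a b → b < c → c < a → Inv ρ a c ⊎ Inv ρ c b
inv-cotrans ρ (i , j , i<j , refl , eⱼ , _) b<c c<a
  with position-of ρ (<-trans c<a (toℕ<n (ρ ⟨$⟩ʳ i)))
... | k , eₖ with toℕ k <? toℕ j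
...   | yes k<j = inj₂ (k , j , k<j , eₖ , eⱼ , b<c)
...   | no k≮j  = inj₁ (i , k , <-≤-trans i<j (≮⇒≥ k≮j) , refl , eₖ , c<a)

-- Not the apartness notion of Relation.Binary: c only ranges between b and a.
Cotransitive : Rel ℕ ℓ → Set ℓ
Cotransitive R = ∀ {a b c} → R a b → b < c → c < a → R a c ⊎ R c b

⁺-least : {R : Rel A ℓ} {S : Rel A ℓ′} → R ⇒ S → Transitive S → TransClosure R ⇒ S
⁺-least R⇒S S-trans [ r ]    = R⇒S r
⁺-least R⇒S S-trans (r ∷ rs) = S-trans (R⇒S r) (⁺-least R⇒S S-trans rs)

⁺-descending : R ⇒ _>_ → TransClosure R ⇒ _>_
⁺-descending R⇒> = ⁺-least R⇒> (λ b<a c<b → <-trans c<b b<a)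

cotransitive-∪ : Cotransitive R → Cotransitive S → Cotransitive (R ∪ S)
cotransitive-∪ R-cot S-cot (inj₁ r) b<c c<a = Sum.map inj₁ inj₁ (R-cot r b<c c<a)
cotransitive-∪ R-cot S-cot (inj₂ s) b<c c<a = Sum.map inj₂ inj₂ (S-cot s b<c c<a)

cotransitive-⁺ : Cotransitive R → Cotransitive (TransClosure R)
cotransitive-⁺ R-cot [ r ] b<c c<a = Sum.map [_] [_] (R-cot r b<c c<a)
cotransitive-⁺ R-cot {c = c} (_∷_ {y = d} r rs) b<c c<a with <-cmp c d
... | tri< c<d _ _  = Sum.map (r ∷_) id (cotransitive-⁺ R-cot rs b<c c<d)
... | tri≈ _ refl _ = inj₁ [ r ]
... | tri> _ _ d<c  = Sum.map [_] (_∷ rs) (R-cot r d<c c<a)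

module _ (ρ : Permutation′ m) {R : Rel ℕ ℓ}
         (R⇒inv : R ⇒ Inv ρ) (R-trans : Transitive R) (R-cot : Cotransitive R) where
  open RawMonad (¬¬-Monad {ℓ})

  private
    distinct-values : {i j : Fin m} → toℕ i < toℕ j → val ρ i ≢ val ρ j
    distinct-values i<j = <⇒≢ i<j ∘ cong toℕ ∘ val-injective ρ

  inversion-through : {i j k : Fin m} → toℕ i < toℕ j → toℕ j < toℕ k → val ρ k < val ρ i →
    (val ρ j < val ρ i → ¬ ¬ R (val ρ i) (val ρ j)) →
    (val ρ k < val ρ j → ¬ ¬ R (val ρ j) (val ρ k)) →
    ¬ ¬ R (val ρ i) (val ρ k)
  inversion-through {i} {j} {k} i<j j<k ρk<ρi left right with <-cmp (val ρ j) (val ρ k)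
  ... | tri≈ _ ρj≡ρk _ = contradiction ρj≡ρk (distinct-values j<k)
  ... | tri< ρj<ρk _ _ = do
    r ← left (<-trans ρj<ρk ρk<ρi)
    [ pure , (λ r′ → contradiction (inv-positions ρ (R⇒inv r′) refl refl) (<-asym j<k)) ]′
      (R-cot r ρj<ρk ρk<ρi)
  ... | tri> _ _ ρk<ρj with <-cmp (val ρ j) (val ρ i)
  ...   | tri≈ _ ρj≡ρi _ = contradiction (sym ρj≡ρi) (distinct-values i<j)
  ...   | tri< ρj<ρi _ _ = do
    r₁ ← left ρj<ρi
    r₂ ← right ρk<ρj
    pure (R-trans r₁ r₂)
  ...   | tri> _ _ ρi<ρj = do
    r ← right ρk<ρj
    [ (λ r′ → contradiction (inv-positions ρ (R⇒inv r′) refl refl) (<-asym i<j)) , pure ]′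
      (R-cot r ρk<ρi ρi<ρj)

  descents-generate :
    (∀ {i j : Fin m} → suc (toℕ i) ≡ toℕ j → val ρ j < val ρ i → ¬ ¬ R (val ρ i) (val ρ j)) →
    ∀ {a b} → Inv ρ a b → ¬ ¬ R a b
  descents-generate descent (i , j , i<j , refl , refl , ρj<ρi) =
    across (toℕ j ∸ suc (toℕ i)) (trans (sym (+-suc _ (toℕ i))) (m∸n+n≡m i<j)) ρj<ρi
    where
    across : ∀ d {i j : Fin m} →
      suc d + toℕ i ≡ toℕ j → val ρ j < val ρ i → ¬ ¬ R (val ρ i) (val ρ j)
    across zero    gap = descent gap
    across (suc d) {i} {j} gap ρj<ρi =
      inversion-through i<next next<j ρj<ρi (descent next≡1+i) (across d gap′)
      where
      1+i<j : suc (toℕ i) < toℕ j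
      1+i<j = subst (suc (toℕ i) <_) gap (s≤s (s≤s (m≤n+m (toℕ i) d)))
      next : Fin m
      next = fromℕ< (<-trans 1+i<j (toℕ<n j))
      next≡1+i : suc (toℕ i) ≡ toℕ next
      next≡1+i = sym (toℕ-fromℕ< _)
      i<next : toℕ i < toℕ next
      i<next = subst (toℕ i <_) next≡1+i ≤-refl
      next<j : toℕ next < toℕ j
      next<j = subst (_< toℕ j) next≡1+i 1+i<j
      gap′ : suc d + toℕ next ≡ toℕ j
      gap′ = trans (cong (suc d +_) (sym next≡1+i)) (trans (+-suc (suc d) (toℕ i)) gap)

transpose-matchˡ : (i j : Fin m) → PC.transpose i j i ≡ j
transpose-matchˡ i j with i ≟ᶠ i
... | yes _   = refl
... | no i≢i = contradiction refl i≢i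

transpose-matchʳ : (i j : Fin m) → PC.transpose i j j ≡ i
transpose-matchʳ i j with j ≟ᶠ i
... | yes j≡i = j≡i
... | no _ with j ≟ᶠ j
...   | yes _   = refl
...   | no j≢j = contradiction refl j≢j

module AdjacentTransposition {i j : Fin m} (adjacent : suc (toℕ i) ≡ toℕ j) where

  i<j : toℕ i < toℕ j
  i<j = subst (toℕ i <_) adjacent ≤-refl

  -- where the entry at position p goes when positions i and j are swapped
  moved : Fin m → Fin m
  moved = PC.transpose j i

  moved-≤ : {p : Fin m} → p ≢ i → toℕ (moved p) ≤ toℕ p
  moved-≤ {p} p≢i with p ≟ᶠ j
  ... | yes refl = <⇒≤ i<j
  ... | no _ with p ≟ᶠ i
  ...   | yes p≡i = contradiction p≡i p≢i
  ...   | no _    = ≤-refl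

  ≤-moved : {q : Fin m} → q ≢ j → toℕ q ≤ toℕ (moved q)
  ≤-moved {q} q≢j with q ≟ᶠ j
  ... | yes q≡j = contradiction q≡j q≢j
  ... | no _ with q ≟ᶠ i
  ...   | yes refl = <⇒≤ i<j
  ...   | no _     = ≤-refl

  moved-monotone : {p q : Fin m} →
    toℕ p < toℕ q → ¬ (p ≡ i × q ≡ j) → toℕ (moved p) < toℕ (moved q)
  moved-monotone {p} {q} p<q not-ij with toℕ p ≟ toℕ i | toℕ q ≟ toℕ j
  ... | yes p≡i | yes q≡j = contradiction (toℕ-injective p≡i , toℕ-injective q≡j) not-ij
  ... | yes p≡i | no q≢j  = begin-strict
    toℕ (moved p) ≡⟨ cong (toℕ ∘ moved) (toℕ-injective p≡i) ⟩
    toℕ (moved i) ≡⟨ cong toℕ (transpose-matchʳ j i) ⟩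
    toℕ j         <⟨ ≤∧≢⇒< (subst (_≤ toℕ q) (trans (cong suc p≡i) adjacent) p<q) (q≢j ∘ sym) ⟩
    toℕ q         ≤⟨ ≤-moved (q≢j ∘ cong toℕ) ⟩
    toℕ (moved q) ∎
    where open ≤-Reasoning
  ... | no p≢i  | yes q≡j = begin-strict
    toℕ (moved p) ≤⟨ moved-≤ (p≢i ∘ cong toℕ) ⟩
    toℕ p         <⟨ ≤∧≢⇒< (≤-pred (subst (toℕ p <_) (trans q≡j (sym adjacent)) p<q)) p≢i ⟩
    toℕ i         ≡⟨ cong toℕ (transpose-matchˡ j i) ⟨
    toℕ (moved j) ≡⟨ cong (toℕ ∘ moved) (toℕ-injective q≡j) ⟨
    toℕ (moved q) ∎
    where open ≤-Reasoning
  ... | no p≢i  | no q≢j  =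
    <-≤-trans (≤-<-trans (moved-≤ (p≢i ∘ cong toℕ)) p<q) (≤-moved (q≢j ∘ cong toℕ))

  swap : Permutation′ m → Permutation′ m
  swap ρ = transpose i j ∘ₚ ρ

  val-swap-moved : (ρ : Permutation′ m) (p : Fin m) → val (swap ρ) (moved p) ≡ val ρ p
  val-swap-moved ρ p = cong (toℕ ∘ (ρ ⟨$⟩ʳ_)) (PC.transpose-inverse i j)

  swap-keeps-inversion : (ρ : Permutation′ m) →
    Inv ρ a b → ¬ (a ≡ val ρ i × b ≡ val ρ j) → Inv (swap ρ) a b
  swap-keeps-inversion ρ (p , q , p<q , refl , refl , b<a) not-ij =
    moved p , moved q , moved-monotone p<q (λ { (refl , refl) → not-ij (refl , refl) }) ,
    val-swap-moved ρ p , val-swap-moved ρ q , b<a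

  swap-removes-inversion : (ρ : Permutation′ m) → ¬ Inv (swap ρ) (val ρ i) (val ρ j)
  swap-removes-inversion ρ inv = <-asym i<j (inv-positions (swap ρ) inv
    (cong (toℕ ∘ (ρ ⟨$⟩ʳ_)) (transpose-matchʳ i j))
    (cong (toℕ ∘ (ρ ⟨$⟩ʳ_)) (transpose-matchˡ i j)))

InvClosure : Permutation′ m → Permutation′ m → Rel ℕ 0ℓ
InvClosure σ τ = TransClosure (Inv σ ∪ Inv τ)

invClosure⊆upper-bound : (σ τ π : Permutation′ m) → σ ≤W π → τ ≤W π → InvClosure σ τ ⇒ Inv π
invClosure⊆upper-bound σ τ π σ≤π τ≤π = ⁺-least [ σ≤π _ _ , τ≤π _ _ ]′ (inv-trans π)

join-descent-in-closure : (σ τ ρ : Permutation′ m) → IsJoin σ τ ρ →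
  {i j : Fin m} → suc (toℕ i) ≡ toℕ j → val ρ j < val ρ i → ¬ ¬ InvClosure σ τ (val ρ i) (val ρ j)
join-descent-in-closure {m} σ τ ρ (σ≤ρ , τ≤ρ , least) {i} {j} adjacent ρj<ρi ¬closure =
  swap-removes-inversion ρ
    (least (swap ρ) (below-swap σ σ≤ρ inj₁) (below-swap τ τ≤ρ inj₂) _ _ (i , j , i<j , refl , refl , ρj<ρi))
  where
  open AdjacentTransposition adjacent
  below-swap : (π : Permutation′ m) → π ≤W ρ → Inv π ⇒ (Inv σ ∪ Inv τ) → π ≤W swap ρ
  below-swap π π≤ρ into a b inv =
    swap-keeps-inversion ρ (π≤ρ a b inv) λ { (refl , refl) → ¬closure [ into inv ] }

join-inversions-in-closure : (σ τ ρ : Permutation′ m) → IsJoin σ τ ρ → Inv ρ a b → ¬ ¬ InvClosure σ τ a b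
join-inversions-in-closure σ τ ρ join@(σ≤ρ , τ≤ρ , _) =
  descents-generate ρ (invClosure⊆upper-bound σ τ ρ σ≤ρ τ≤ρ) _++_
    (cotransitive-⁺ (cotransitive-∪ (inv-cotrans σ) (inv-cotrans τ)))
    (join-descent-in-closure σ τ ρ join)

record WigglyClosed (n : ℕ) (R : Rel ℕ ℓ) : Set ℓ where
  field
    from-even : k < n → R (2 * k) a → R (2 * k + 1) a
    onto-even : k < n → R a (2 * k) → 2 * k + 1 < a → R a (2 * k + 1)

n<n+1 : ∀ n → n < n + 1
n<n+1 n = m<m+n n z<s

2k+1<2n : k < n → 2 * k + 1 < 2 * n
2k+1<2n {k} {n} k<n = subst (_≤ 2 * n) (eq k) (*-monoʳ-≤ 2 k<n)
  where
  eq : ∀ k → 2 * suc k ≡ suc (2 * k + 1)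
  eq = solve-∀

wiggly⇒closed : (σ : Permutation′ (2 * n)) → Wiggly n σ → WigglyClosed n (Inv σ)
wiggly⇒closed {n} σ wiggly = record { from-even = from-even ; onto-even = onto-even }
  where
  from-even : k < n → Inv σ (2 * k) a → Inv σ (2 * k + 1) a
  from-even {k} k<n (p , q , p<q , σp≡2k , σq≡a , a<2k) with position-of σ (2k+1<2n k<n)
  ... | r , σr≡2k+1 with <-cmp (toℕ r) (toℕ q)
  ... | tri< r<q _ _ = r , q , r<q , σr≡2k+1 , σq≡a , <-trans a<2k (n<n+1 (2 * k))
  ... | tri≈ _ r≡q _ = contradiction
    (trans (sym σr≡2k+1) (trans (cong (val σ) (toℕ-injective r≡q)) σq≡a)) (>⇒≢ (<-trans a<2k (n<n+1 (2 * k))))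
  ... | tri> _ _ q<r = contradiction (σp≡2k , σr≡2k+1 , subst (_< 2 * k) (sym σq≡a) a<2k)
                                     (proj₁ (wiggly k k<n p q r p<q q<r))

  onto-even : k < n → Inv σ a (2 * k) → 2 * k + 1 < a → Inv σ a (2 * k + 1)
  onto-even {k} k<n (q , r , q<r , σq≡a , σr≡2k , _) 2k+1<a with position-of σ (2k+1<2n k<n)
  ... | p , σp≡2k+1 with <-cmp (toℕ q) (toℕ p)
  ... | tri< q<p _ _ = q , p , q<p , σq≡a , σp≡2k+1 , 2k+1<a
  ... | tri≈ _ q≡p _ = contradiction
    (trans (sym σp≡2k+1) (trans (cong (val σ) (toℕ-injective (sym q≡p))) σq≡a)) (<⇒≢ 2k+1<a)
  ... | tri> _ _ p<q = contradiction (σp≡2k+1 , σr≡2k , subst (2 * k + 1 <_) (sym σq≡a) 2k+1<a)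
                                     (proj₂ (wiggly k k<n p q r p<q q<r))

wigglyClosed-∪ : WigglyClosed n R → WigglyClosed n S → WigglyClosed n (R ∪ S)
wigglyClosed-∪ R-closed S-closed = record
  { from-even = λ k<n → Sum.map (R.from-even k<n) (S.from-even k<n)
  ; onto-even = λ k<n r∪s 2k+1<a →
      Sum.map (λ r → R.onto-even k<n r 2k+1<a) (λ s → S.onto-even k<n s 2k+1<a) r∪s
  }
  where
  module R = WigglyClosed R-closed
  module S = WigglyClosed S-closed

wigglyClosed-⁺ : R ⇒ _>_ → WigglyClosed n R → WigglyClosed n (TransClosure R)
wigglyClosed-⁺ {R = R} {n = n} R⇒> R-closed = record { from-even = from-even ; onto-even = onto-even }
  where
  module R = WigglyClosed R-closed

  from-even : k < n → TransClosure R (2 * k) a → TransClosure R (2 * k + 1) a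
  from-even k<n [ r ]    = [ R.from-even k<n r ]
  from-even k<n (r ∷ rs) = R.from-even k<n r ∷ rs

  onto-even : k < n → TransClosure R a (2 * k) → 2 * k + 1 < a → TransClosure R a (2 * k + 1)
  onto-even k<n [ r ] 2k+1<a = [ R.onto-even k<n r 2k+1<a ]
  onto-even {k} k<n (_∷_ {y = c} r rs) 2k+1<a with <-cmp c (2 * k + 1)
  ... | tri< c<2k+1 _ _ =
    contradiction (m<1+n⇒m≤n (subst (c <_) (+-comm (2 * k) 1) c<2k+1)) (<⇒≱ (⁺-descending R⇒> rs))
  ... | tri≈ _ refl _   = [ r ]
  ... | tri> _ _ 2k+1<c = r ∷ onto-even k<n rs 2k+1<c

wiggly-from-closed : (ρ : Permutation′ (2 * n)) → WigglyClosed n R → R ⇒ Inv ρ → (∀ {a b} → Inv ρ a b → ¬ ¬ R a b) →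
  Wiggly n ρ
wiggly-from-closed ρ R-closed R⇒inv inv⇒R k k<n p q r p<q q<r = even-first , odd-first
  where
  open WigglyClosed R-closed
  even-first : ¬ (val ρ p ≡ 2 * k × val ρ r ≡ 2 * k + 1 × val ρ q < 2 * k)
  even-first (ρp≡2k , ρr≡2k+1 , ρq<2k) =
    inv⇒R (p , q , p<q , ρp≡2k , refl , ρq<2k) λ inv →
    <-asym q<r (inv-positions ρ (R⇒inv (from-even k<n inv)) ρr≡2k+1 refl)
  odd-first : ¬ (val ρ p ≡ 2 * k + 1 × val ρ r ≡ 2 * k × 2 * k + 1 < val ρ q)
  odd-first (ρp≡2k+1 , ρr≡2k , 2k+1<ρq) =
    inv⇒R (q , r , q<r , refl , ρr≡2k , <-trans (n<n+1 (2 * k)) 2k+1<ρq) λ inv →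
    <-asym p<q (inv-positions ρ (R⇒inv (onto-even k<n inv 2k+1<ρq)) refl ρp≡2k+1)

join-wiggly : (σ τ : Permutation′ (2 * n)) → Wiggly n σ → Wiggly n τ →
  (ρ : Permutation′ (2 * n)) → IsJoin σ τ ρ → Wiggly n ρ
join-wiggly {n} σ τ σ-wiggly τ-wiggly ρ join@(σ≤ρ , τ≤ρ , _) =
  wiggly-from-closed ρ closure-closed (invClosure⊆upper-bound σ τ ρ σ≤ρ τ≤ρ)
    (join-inversions-in-closure σ τ ρ join)
  where
  closure-closed : WigglyClosed n (InvClosure σ τ)
  closure-closed = wigglyClosed-⁺ [ inv-descending σ , inv-descending τ ]′
    (wigglyClosed-∪ (wiggly⇒closed σ σ-wiggly) (wiggly⇒closed τ τ-wiggly))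

complement : Permutation′ m → Permutation′ m
complement ρ = ρ ∘ₚ reverse

complement-involutive : (ρ : Permutation′ m) → complement (complement ρ) ≈ ρ
complement-involutive ρ i = opposite-involutive (ρ ⟨$⟩ʳ i)

val-complement : (ρ : Permutation′ m) (i : Fin m) → val ρ i ≡ m ∸ suc (val (complement ρ) i)
val-complement ρ i =
  trans (cong toℕ (sym (complement-involutive ρ i))) (opposite-prop (opposite (ρ ⟨$⟩ʳ i)))

complement-<-reflect : (ρ : Permutation′ m) {i j : Fin m} →
  val (complement ρ) j < val (complement ρ) i → val ρ i < val ρ j
complement-<-reflect ρ {i} {j} lt =
  subst₂ _<_ (sym (val-complement ρ i)) (sym (val-complement ρ j)) (∸-monoʳ-< (s≤s lt) (toℕ<n _))

inv-resp-≈ : (σ τ : Permutation′ m) → σ ≈ τ → Inv σ a b → Inv τ a b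
inv-resp-≈ σ τ σ≈τ (i , j , i<j , σi≡a , σj≡b , b<a) =
  i , j , i<j , trans (cong toℕ (sym (σ≈τ i))) σi≡a , trans (cong toℕ (sym (σ≈τ j))) σj≡b , b<a

complement-antitone : (σ τ : Permutation′ m) → σ ≤W τ → complement τ ≤W complement σ
complement-antitone σ τ σ≤τ _ _ (i , j , i<j , refl , refl , cτj<cτi) =
  at i , at j , at-monotone , cong (toℕ ∘ opposite) (inverseʳ σ) , cong (toℕ ∘ opposite) (inverseʳ σ) ,
  cτj<cτi
  where
  at : Fin _ → Fin _
  at p = σ ⟨$⟩ˡ (τ ⟨$⟩ʳ p)
  val-at : ∀ p → val σ (at p) ≡ val τ p
  val-at p = cong toℕ (inverseʳ σ)
  τi<τj : val τ i < val τ j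
  τi<τj = complement-<-reflect τ cτj<cτi
  at-monotone : toℕ (at i) < toℕ (at j)
  at-monotone with <-cmp (toℕ (at i)) (toℕ (at j))
  ... | tri< lt _ _  = lt
  ... | tri≈ _ eq _  = contradiction
    (trans (sym (val-at i)) (trans (cong (val σ) (toℕ-injective eq)) (val-at j))) (<⇒≢ τi<τj)
  ... | tri> _ _ gt = contradiction
    (inv-positions τ (σ≤τ _ _ (at j , at i , gt , val-at j , val-at i , τi<τj)) refl refl) (<-asym i<j)

complement-swap : (σ π : Permutation′ m) → complement σ ≤W π → complement π ≤W σ
complement-swap σ π cσ≤π a b =
  inv-resp-≈ (complement (complement σ)) σ (complement-involutive σ)
  ∘ complement-antitone (complement σ) π cσ≤π a b

complement-meet : (σ τ ρ : Permutation′ m) → IsMeet σ τ ρ → IsJoin (complement σ) (complement τ) (complement ρ)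
complement-meet σ τ ρ (ρ≤σ , ρ≤τ , greatest) =
  complement-antitone ρ σ ρ≤σ , complement-antitone ρ τ ρ≤τ ,
  λ π cσ≤π cτ≤π → complement-swap π ρ
    (greatest (complement π) (complement-swap σ π cσ≤π) (complement-swap τ π cτ≤π))

complement-pair : k < n →
  ∃ λ k′ → k′ < n × 2 * n ∸ suc (2 * k) ≡ 2 * k′ + 1 × 2 * n ∸ suc (2 * k + 1) ≡ 2 * k′
complement-pair {k} k<n with m≤n⇒∃[o]m+o≡n k<n
... | e , refl = e , s≤s (m≤n+m e k) , even↦odd , odd↦even
  where
  split-even : ∀ k e → 2 * (suc k + e) ≡ suc (2 * k) + (2 * e + 1)
  split-even = solve-∀
  split-odd : ∀ k e → 2 * (suc k + e) ≡ suc (2 * k + 1) + 2 * e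
  split-odd = solve-∀
  even↦odd : 2 * (suc k + e) ∸ suc (2 * k) ≡ 2 * e + 1
  even↦odd = trans (cong (_∸ suc (2 * k)) (split-even k e)) (m+n∸m≡n (suc (2 * k)) _)
  odd↦even : 2 * (suc k + e) ∸ suc (2 * k + 1) ≡ 2 * e
  odd↦even = trans (cong (_∸ suc (2 * k + 1)) (split-odd k e)) (m+n∸m≡n (suc (2 * k + 1)) _)

complement-wiggly : (σ : Permutation′ (2 * n)) → Wiggly n σ → Wiggly n (complement σ)
complement-wiggly {n} σ wiggly k k<n p q r p<q q<r with complement-pair k<n
... | k′ , k′<n , even↦odd , odd↦even = even-first , odd-first
  where
  σᶜ : Permutation′ (2 * n)
  σᶜ = complement σ
  σ-value : ∀ {x v} → val σᶜ x ≡ v → val σ x ≡ 2 * n ∸ suc v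
  σ-value {x} refl = val-complement σ x
  σ-above : ∀ {x v} → val σᶜ x < v → v < 2 * n → 2 * n ∸ suc v < val σ x
  σ-above {x} lt v<2n = subst (_ <_) (sym (val-complement σ x)) (∸-monoʳ-< (s≤s lt) v<2n)
  σ-below : ∀ {x v} → v < val σᶜ x → val σ x < 2 * n ∸ suc v
  σ-below {x} lt = subst (_< _) (sym (val-complement σ x)) (∸-monoʳ-< (s≤s lt) (toℕ<n _))

  even-first : ¬ (val σᶜ p ≡ 2 * k × val σᶜ r ≡ 2 * k + 1 × val σᶜ q < 2 * k)
  even-first (p≡2k , r≡2k+1 , q<2k) = proj₂ (wiggly k′ k′<n p q r p<q q<r)
    ( trans (σ-value p≡2k) even↦odd
    , trans (σ-value r≡2k+1) odd↦even
    , subst (_< val σ q) even↦odd (σ-above q<2k (<-trans (n<n+1 (2 * k)) (2k+1<2n k<n))) )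
  odd-first : ¬ (val σᶜ p ≡ 2 * k + 1 × val σᶜ r ≡ 2 * k × 2 * k + 1 < val σᶜ q)
  odd-first (p≡2k+1 , r≡2k , 2k+1<q) = proj₁ (wiggly k′ k′<n p q r p<q q<r)
    ( trans (σ-value p≡2k+1) odd↦even
    , trans (σ-value r≡2k) even↦odd
    , subst (val σ q <_) odd↦even (σ-below 2k+1<q) )

wiggly-resp-≈ : (σ τ : Permutation′ (2 * n)) → σ ≈ τ → Wiggly n σ → Wiggly n τ
wiggly-resp-≈ σ τ σ≈τ wiggly k k<n p q r p<q q<r
  rewrite sym (σ≈τ p) | sym (σ≈τ q) | sym (σ≈τ r) = wiggly k k<n p q r p<q q<r

meet-wiggly : (σ τ : Permutation′ (2 * n)) → Wiggly n σ → Wiggly n τ →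
  (ρ : Permutation′ (2 * n)) → IsMeet σ τ ρ → Wiggly n ρ
meet-wiggly σ τ σ-wiggly τ-wiggly ρ meet =
  wiggly-resp-≈ (complement (complement ρ)) ρ (complement-involutive ρ)
    (complement-wiggly (complement ρ)
      (join-wiggly (complement σ) (complement τ) (complement-wiggly σ σ-wiggly) (complement-wiggly τ τ-wiggly)
        (complement ρ) (complement-meet σ τ ρ meet)))

proposition2p30 : ∀ (n : ℕ) → 1 ≤ n → ∀ (σ τ : Permutation′ (2 * n)) →
    Wiggly n σ → Wiggly n τ →
    (∀ (ρ : Permutation′ (2 * n)) → IsJoin σ τ ρ → Wiggly n ρ)
  × (∀ (ρ : Permutation′ (2 * n)) → IsMeet σ τ ρ → Wiggly n ρ)
proposition2p30 n _ σ τ σ-wiggly τ-wiggly =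
  join-wiggly σ τ σ-wiggly τ-wiggly , meet-wiggly σ τ σ-wiggly τ-wiggly
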